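{- For all positive integers $s$ and $n$ with $2\le n\le 2s^2+2s+1$, the set $\{s,s+1\}\subseteq\mathbb{Z}_n$ is an $s$-spanning set of $\mathbb{Z}_n$, i.e. every element of $\mathbb{Z}_n$ can be written as $\lambda_1 s+\lambda_2(s+1)$ for some integers $\lambda_1,\lambda_2$ with $|\lambda_1|+|\lambda_2|\le s$.
   Context: $\mathbb{Z}_n=\mathbb{Z}/n\mathbb{Z}$; the integers $s$, $s+1$ are regarded as elements of $\mathbb{Z}_n$ via reduction mod $n$. A subset $A$ of an abelian group $G$ is an $s$-spanning set if every element of $G$ is a signed sum of at most $s$ (not necessarily distinct) elements of $A$. -}

module Defs where

open import Data.Nat using (ℕ; _≤_)
open import Data.Integer using (ℤ; _+_; _-_; _*_; +_; -_)
open import Data.Integer.Divisibility using (_∣_)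
open import Data.List using (List; []; _∷_; length)
open import Data.List.Relation.Unary.All using (All)
open import Data.List.Membership.Propositional using (_∈_)
open import Data.Bool using (Bool; true; false)
open import Data.Product using (Σ; _×_; _,_; proj₂)

-- Z_n is modelled as ℤ modulo the congruence  a ≡ b [mod n]  (n ∣ a - b);
-- elements of Z_n are represented by integers (every residue class has one).
_≡_[mod_] : ℤ → ℤ → ℕ → Set
a ≡ b [mod n ] = (+ n) ∣ (a - b)

signed : Bool → ℤ → ℤ
signed true  a = a
signed false a = - a

signedSum : List (Bool × ℤ) → ℤ
signedSum []             = + 0
signedSum ((b , a) ∷ ts) = signed b a + signedSum ts

-- A ⊆ Z_n (given by integer representatives, listed) is an s-spanning set of Z_n
-- if every element of Z_n is a signed sum of at most s (not necessarily distinct)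
-- elements of A.
IsSpanning : (n : ℕ) → (s : ℕ) → (A : List ℤ) → Set
IsSpanning n s A =
  (x : ℤ) → Σ (List (Bool × ℤ)) λ ts →
    (length ts ≤ s) × All (λ t → proj₂ t ∈ A) ts × (signedSum ts ≡ x [mod n ])

module Submission where

-- Every v with 0 ≤ v ≤ s² + s is λ₁ s + λ₂ (s + 1) with |λ₁| + |λ₂| ≤ s: divide v by s and
-- trade copies of s against copies of s + 1. As n ≤ 2(s² + s) + 1,
-- every residue class mod n contains v or -v for such a v, and negating the coefficients
-- handles -v.

open import Defs
open import Data.Nat using (ℕ; _≤_; _+_; _*_)
open import Data.Integer using (+_)
open import Data.List using (_∷_; [])

open import Data.Bool using (Bool; true; false)
open import Data.Integer as ℤ using (ℤ; -_; _-_; -[1+_]; ∣_∣)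
open import Data.Integer.DivMod using (_/ℕ_; _%ℕ_; a≡a%ℕn+[a/ℕn]*n; n%ℕd<d)
open import Data.Integer.Divisibility.Signed using (divides; ∣⇒∣ᵤ)
open import Data.Integer.Properties
  using (∣-i∣≡∣i∣; pos-*; +-identityˡ; +-assoc; suc-*; neg-distribʳ-*; neg-distribˡ-*)
open import Data.Integer.Tactic.RingSolver using (solve-∀)
open import Data.List using (List; length; replicate; _++_)
open import Data.List.Membership.Propositional using (_∈_)
open import Data.List.Properties using (length-++; length-replicate)
open import Data.List.Relation.Unary.All using (All)
open import Data.List.Relation.Unary.All.Properties using (++⁺; replicate⁺)
open import Data.List.Relation.Unary.Any using (here; there)
open import Data.Nat as ℕ using (zero; suc; NonZero; >-nonZero; _<_; _≤?_; s≤s; z≤n)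
open import Data.Nat.DivMod using (_/_; _%_; m≡m%n+[m/n]*n; m%n<n)
open import Data.Nat.Properties
  using (≤-refl; ≤-trans; ≤-antisym; <⇒≤; ≰⇒>; +-comm; +-suc; +-monoʳ-≤; +-monoˡ-≤;
         +-cancelˡ-<; +-cancelˡ-≤; *-monoˡ-≤; m≤n+m; m≤n⇒∃[o]m+o≡n; module ≤-Reasoning)
import Data.Nat.Tactic.RingSolver as ℕ-Solver
open import Data.Product using (Σ; _×_; _,_; proj₂)
open import Data.Sum using (_⊎_; inj₁; inj₂)
open import Relation.Binary.PropositionalEquality
open import Relation.Nullary using (yes; no)

signedSum-++ : ∀ xs ys → signedSum (xs ++ ys) ≡ signedSum xs ℤ.+ signedSum ys
signedSum-++ []             ys = sym (+-identityˡ (signedSum ys))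
signedSum-++ ((b , a) ∷ xs) ys =
  trans (cong (λ z → signed b a ℤ.+ z) (signedSum-++ xs ys)) (sym (+-assoc (signed b a) _ _))

signedSum-replicate : ∀ k b a → signedSum (replicate k (b , a)) ≡ + k ℤ.* signed b a
signedSum-replicate zero    b a = refl
signedSum-replicate (suc k) b a =
  trans (cong (λ z → signed b a ℤ.+ z) (signedSum-replicate k b a)) (sym (suc-* (+ k) (signed b a)))

isNonNegative : ℤ → Bool
isNonNegative (+ _)    = true
isNonNegative -[1+ _ ] = false

scaled : ℤ → ℤ → List (Bool × ℤ)
scaled c a = replicate ∣ c ∣ (isNonNegative c , a)

signedSum-scaled : ∀ c a → signedSum (scaled c a) ≡ c ℤ.* a
signedSum-scaled (+ k)    a = signedSum-replicate k true a
signedSum-scaled -[1+ k ] a = trans (signedSum-replicate (suc k) false a)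
  (trans (sym (neg-distribʳ-* (+ suc k) a)) (neg-distribˡ-* (+ suc k) a))

record Representation (s : ℕ) (v : ℤ) : Set where
  field
    λ₁ λ₂ : ℤ
    cost  : ∣ λ₁ ∣ + ∣ λ₂ ∣ ≤ s
    value : λ₁ ℤ.* + s ℤ.+ λ₂ ℤ.* + (s + 1) ≡ v

representation-neg : ∀ {s v} → Representation s v → Representation s (- v)
representation-neg {s} r = record
  { λ₁    = - λ₁
  ; λ₂    = - λ₂
  ; cost  = subst₂ (λ a b → a + b ≤ s) (sym (∣-i∣≡∣i∣ λ₁)) (sym (∣-i∣≡∣i∣ λ₂)) cost
  ; value = trans (neg-linear λ₁ λ₂ (+ s) (+ (s + 1))) (cong -_ value)
  }
  where
  open Representation r
  neg-linear : ∀ a b x y → (- a) ℤ.* x ℤ.+ (- b) ℤ.* y ≡ - (a ℤ.* x ℤ.+ b ℤ.* y)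
  neg-linear = solve-∀

signedSum-representation : ∀ {s v} → Representation s v →
  Σ (List (Bool × ℤ)) λ ts →
    (length ts ≤ s) × All (λ t → proj₂ t ∈ ((+ s) ∷ (+ (s + 1)) ∷ [])) ts × (signedSum ts ≡ v)
signedSum-representation {s} {v} r =
  ts , length-ts , ++⁺ (replicate⁺ ∣ λ₁ ∣ (here refl)) (replicate⁺ ∣ λ₂ ∣ (there (here refl))) , sum-ts
  where
  open Representation r
  ts : List (Bool × ℤ)
  ts = scaled λ₁ (+ s) ++ scaled λ₂ (+ (s + 1))
  length-ts : length ts ≤ s
  length-ts = subst (_≤ s)
    (sym (trans (length-++ (scaled λ₁ (+ s))) (cong₂ _+_ (length-replicate ∣ λ₁ ∣) (length-replicate ∣ λ₂ ∣))))
    cost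
  sum-ts : signedSum ts ≡ v
  sum-ts = trans (signedSum-++ (scaled λ₁ (+ s)) _)
    (trans (cong₂ ℤ._+_ (signedSum-scaled λ₁ (+ s)) (signedSum-scaled λ₂ (+ (s + 1)))) value)

spanning-if-representable : ∀ n s → (∀ x → Σ ℤ λ v → Representation s v × v ≡ x [mod n ]) →
  IsSpanning n s ((+ s) ∷ (+ (s + 1)) ∷ [])
spanning-if-representable n s representable x with representable x
... | v , r , v≡x with signedSum-representation r
...   | ts , length-ts , ts⊆A , sum≡v = ts , length-ts , ts⊆A , subst (_≡ x [mod n ]) (sym sum≡v) v≡x

representation-nonneg : ∀ s r d → d + r ≤ s → Representation s (+ r ℤ.+ + (r + d) ℤ.* + s)
representation-nonneg s r d cost = record
  { λ₁ = + d ; λ₂ = + r ; cost = cost ; value = identity (+ d) (+ r) (+ s) }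
  where
  identity : ∀ D R S → D ℤ.* S ℤ.+ R ℤ.* (S ℤ.+ + 1) ≡ R ℤ.+ (R ℤ.+ D) ℤ.* S
  identity = solve-∀

representation-subtracting-s : ∀ s q e → e + (q + e) ≤ s →
  Representation s (+ (q + e) ℤ.+ + q ℤ.* + s)
representation-subtracting-s s q e cost = record
  { λ₁    = - + e
  ; λ₂    = + (q + e)
  ; cost  = subst (λ a → a + (q + e) ≤ s) (sym (∣-i∣≡∣i∣ (+ e))) cost
  ; value = identity (+ q) (+ e) (+ s)
  }
  where
  identity : ∀ Q E S → (- E) ℤ.* S ℤ.+ (Q ℤ.+ E) ℤ.* (S ℤ.+ + 1) ≡ (Q ℤ.+ E) ℤ.+ Q ℤ.* S
  identity = solve-∀

representation-subtracting-s+1 : ∀ q e t → t < e →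
  Representation (q + e + t) (+ (q + e) ℤ.+ + q ℤ.* + (q + e + t))
representation-subtracting-s+1 q e t t<e = record
  { λ₁    = + suc (q + t)
  ; λ₂    = - + t
  ; cost  = subst (λ a → suc (q + t) + a ≤ q + e + t) (sym (∣-i∣≡∣i∣ (+ t)))
              (+-monoˡ-≤ t (subst (_≤ q + e) (+-suc q t) (+-monoʳ-≤ q t<e)))
  ; value = identity (+ q) (+ e) (+ t)
  }
  where
  identity : ∀ Q E T →
    (+ 1 ℤ.+ (Q ℤ.+ T)) ℤ.* (Q ℤ.+ E ℤ.+ T) ℤ.+ (- T) ℤ.* (Q ℤ.+ E ℤ.+ T ℤ.+ + 1)
      ≡ (Q ℤ.+ E) ℤ.+ Q ℤ.* (Q ℤ.+ E ℤ.+ T)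
  identity = solve-∀

-- Write v = r + q s with r < s and q ≤ s. If r ≤ q, then v = (q - r) s + r (s + 1) costs q.
-- Otherwise v = r (s + 1) - (r - q) s and v = (q + 1 + (s - r)) s - (s - r) (s + 1) cost
-- 2r - q and 2s + 1 - (2r - q), so one of them costs at most s.
representation-quotRem : ∀ s q r → r < s → q ≤ s → Representation s (+ r ℤ.+ + q ℤ.* + s)
representation-quotRem s q r r<s q≤s with r ≤? q
... | yes r≤q with m≤n⇒∃[o]m+o≡n r≤q
...   | d , refl = representation-nonneg s r d (subst (_≤ s) (+-comm r d) q≤s)
representation-quotRem s q r r<s q≤s | no r≰q
  with m≤n⇒∃[o]m+o≡n (<⇒≤ (≰⇒> r≰q)) | m≤n⇒∃[o]m+o≡n (<⇒≤ r<s)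
... | e , refl | t , refl with e + (q + e) ≤? q + e + t
...   | yes fits = representation-subtracting-s (q + e + t) q e fits
...   | no ¬fits = representation-subtracting-s+1 q e t
                     (+-cancelˡ-< (q + e) t e (subst (q + e + t <_) (+-comm e (q + e)) (≰⇒> ¬fits)))

pos-quotRem : ∀ {v} r q s → v ≡ r + q * s → + v ≡ + r ℤ.+ + q ℤ.* + s
pos-quotRem r q s refl = cong (λ z → + r ℤ.+ z) (pos-* q s)

representation-small : ∀ s .{{_ : NonZero s}} v → v ≤ s * s + s → Representation s (+ v)
representation-small s v v≤ with v / s ≤? s
... | yes q≤s = subst (Representation s) (sym (pos-quotRem (v % s) (v / s) s (m≡m%n+[m/n]*n v s)))
                  (representation-quotRem s (v / s) (v % s) (m%n<n v s) q≤s)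
... | no q≰s = subst (Representation s) (sym (pos-quotRem s (s + 0) s v≡s+s²))
                  (representation-nonneg s s 0 ≤-refl)
  where
  s²+s≤v : s * s + s ≤ v
  s²+s≤v = begin
    s * s + s           ≡⟨ +-comm (s * s) s ⟩
    suc s * s           ≤⟨ *-monoˡ-≤ s (≰⇒> q≰s) ⟩
    (v / s) * s         ≤⟨ m≤n+m _ (v % s) ⟩
    v % s + (v / s) * s ≡⟨ m≡m%n+[m/n]*n v s ⟨
    v                   ∎
    where open ≤-Reasoning
  v≡s+s² : v ≡ s + (s + 0) * s
  v≡s+s² = trans (≤-antisym v≤ s²+s≤v) (identity s)
    where
    identity : ∀ s → s * s + s ≡ s + (s + 0) * s
    identity = ℕ-Solver.solve-∀

≡[mod]-from-quotient : ∀ {n} v x k → v - x ≡ k ℤ.* + n → v ≡ x [mod n ]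
≡[mod]-from-quotient v x k eq = ∣⇒∣ᵤ (divides k eq)

-- If the residue r exceeds m, then n - r ≤ m because n ≤ 2m + 1.
small-representative : ∀ m n → n ≤ 2 * m + 1 → ∀ x r k → r < n → x ≡ + r ℤ.+ k ℤ.* + n →
  Σ ℕ λ w → w ≤ m × ((+ w) ≡ x [mod n ] ⊎ (- + w) ≡ x [mod n ])
small-representative m n n≤ x r k r<n x≡ with r ≤? m | m≤n⇒∃[o]m+o≡n (<⇒≤ r<n)
... | yes r≤m | _ =
  r , r≤m , inj₁ (≡[mod]-from-quotient (+ r) x (- k)
                    (trans (cong (λ y → + r - y) x≡) (identity (+ r) k (+ n))))
  where
  identity : ∀ R K N → R - (R ℤ.+ K ℤ.* N) ≡ (- K) ℤ.* N
  identity = solve-∀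
... | no r≰m | w , refl =
  w , w≤m , inj₂ (≡[mod]-from-quotient (- + w) x (- (k ℤ.+ + 1))
                    (trans (cong (λ y → - + w - y) x≡) (identity (+ r) (+ w) k)))
  where
  w≤m : w ≤ m
  w≤m = +-cancelˡ-≤ (suc m) w m (≤-trans (+-monoˡ-≤ w (≰⇒> r≰m)) (subst (r + w ≤_) (split m) n≤))
    where
    split : ∀ m → 2 * m + 1 ≡ suc m + m
    split = ℕ-Solver.solve-∀
  identity : ∀ R W K → - W - (R ℤ.+ K ℤ.* (R ℤ.+ W)) ≡ (- (K ℤ.+ + 1)) ℤ.* (R ℤ.+ W)
  identity = solve-∀

mainTheorem4 : (s n : ℕ) → 1 ≤ s → 2 ≤ n → n ≤ 2 * (s * s) + 2 * s + 1 →
    IsSpanning n s ((+ s) ∷ (+ (s + 1)) ∷ [])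
mainTheorem4 s n 1≤s 2≤n n≤ = spanning-if-representable n s representable
  where
  instance
    s≢0 : NonZero s
    s≢0 = >-nonZero 1≤s
    n≢0 : NonZero n
    n≢0 = >-nonZero (≤-trans (s≤s z≤n) 2≤n)
  n≤2m+1 : n ≤ 2 * (s * s + s) + 1
  n≤2m+1 = subst (n ≤_) (identity s) n≤
    where
    identity : ∀ s → 2 * (s * s) + 2 * s + 1 ≡ 2 * (s * s + s) + 1
    identity = ℕ-Solver.solve-∀
  representable : ∀ x → Σ ℤ λ v → Representation s v × v ≡ x [mod n ]
  representable x
    with small-representative (s * s + s) n n≤2m+1 x (x %ℕ n) (x /ℕ n) (n%ℕd<d x n) (a≡a%ℕn+[a/ℕn]*n x n)
  ... | w , w≤ , inj₁ w≡x  = + w , representation-small s w w≤ , w≡x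
  ... | w , w≤ , inj₂ -w≡x = - + w , representation-neg (representation-small s w w≤) , -w≡x
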